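{- For all non-negative integers $n$, \[T_{n+2}^2=c_n^2+\sum_{k=2}^n\sum_{l=2}^k\{4(T_l+T_{l-1})-\delta_{l,2}-2p_{l-1}\}T_{k-l+2}^2c_{n-k}^2.\]
   Context: Tribonacci numbers: $T_n=T_{n-1}+T_{n-2}+T_{n-3}+\delta_{n,2}$ for all integers $n$, with $T_n=0$ for $n<2$. Narayana's cows sequence: $c_n=c_{n-1}+c_{n-3}+\delta_{n,0}$, $c_n=0$ for $n<0$. Padovan numbers (in this offset): $p_n=p_{n-2}+p_{n-3}+\delta_{n,0}$, $p_n=0$ for $n<0$. $\delta_{i,j}$ is $1$ if $i=j$ and $0$ otherwise. Empty sums are zero. -}

module Defs where

open import Data.Nat as ℕ using (ℕ; zero; suc)
open import Data.Integer using (ℤ; +_; _+_; _-_; _*_)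
open import Relation.Nullary using (yes; no)

T : ℕ → ℕ
T 0 = 0
T 1 = 0
T 2 = 1
T (suc (suc (suc n))) = T (suc (suc n)) ℕ.+ T (suc n) ℕ.+ T n

c : ℕ → ℕ
c 0 = 1
c 1 = 1
c 2 = 1
c (suc (suc (suc n))) = c (suc (suc n)) ℕ.+ c n

p : ℕ → ℕ
p 0 = 1
p 1 = 0
p 2 = 1
p (suc (suc (suc n))) = p (suc n) ℕ.+ p n

δ : ℕ → ℕ → ℤ
δ i j with i ℕ.≟ j
... | yes _ = + 1
... | no _ = + 0

-- Σ[ i = a .. b ] f i  =  f a + … + f b  (zero if b < a)
sumFromTo : ℕ → ℕ → (ℕ → ℤ) → ℤ
sumFromTo a b f = go (suc b ℕ.∸ a)
  where
  go : ℕ → ℤ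
  go zero = + 0
  go (suc m) = go m + f (a ℕ.+ m)

{-# OPTIONS --safe #-}
-- Work with generating functions S = Σ T_{n+2}² xⁿ, D = Σ c_n² xⁿ, U = Σ T_{n+2} xⁿ and
-- V = Σ p_n xⁿ. Squares of solutions of a third-order recurrence satisfy a sixth-order one, so
-- Q_S S = P_S and Q_D D = P_D with deg Q = 6, and the numerators turn out to be
-- P_S = 1 - x - x² - x³ and P_D = 1 - x² - x³, the denominators of U and V. Hence
-- (Q_D V - Q_S U) S D = (Q_D / P_D) S D - (Q_S / P_S) S D = S - D, and the coefficients of
-- Q_D V - Q_S U are the bracket of the statement for l ≥ 2 and vanish for l < 2.
module Submission where

open import Defs
open import Data.Nat using (ℕ; _∸_)
open import Data.Integer using (ℤ; +_; _+_; _-_; _*_)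
open import Relation.Binary.PropositionalEquality using (_≡_)

open import Data.Nat as ℕ using (zero; suc)
open import Data.Integer using (-_)
open import Data.Integer.Properties
  using (*-comm; *-assoc; *-identityˡ; *-distribʳ-+; +-identityˡ; +-identityʳ; +-comm; +-assoc)
open import Data.Integer.Tactic.RingSolver using (solve; solve-∀)
open import Data.List using (List; []; _∷_; length)
open import Function using (_∘_)
open import Relation.Binary.PropositionalEquality
  using (_≗_; refl; sym; trans; cong; cong₂; module ≡-Reasoning)

Seq : Set
Seq = ℕ → ℤ

𝟘 : Seq
𝟘 _ = + 0

𝟙 : Seq
𝟙 zero = + 1
𝟙 (suc _) = + 0

infixl 7 _⋆_

_⋆_ : Seq → Seq → Seq
(f ⋆ g) zero = f 0 * g 0
(f ⋆ g) (suc n) = f 0 * g (suc n) + ((f ∘ suc) ⋆ g) n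

⋆-zeroˡ : ∀ g → 𝟘 ⋆ g ≗ 𝟘
⋆-zeroˡ g zero = refl
⋆-zeroˡ g (suc n) = cong (_+_ (+ 0 * g (suc n))) (⋆-zeroˡ g n)

⋆-identityˡ : ∀ g → 𝟙 ⋆ g ≗ g
⋆-identityˡ g zero = *-identityˡ (g 0)
⋆-identityˡ g (suc n) = begin
  + 1 * g (suc n) + (𝟘 ⋆ g) n ≡⟨ cong (_+_ (+ 1 * g (suc n))) (⋆-zeroˡ g n) ⟩
  + 1 * g (suc n) + + 0       ≡⟨ +-identityʳ _ ⟩
  + 1 * g (suc n)             ≡⟨ *-identityˡ _ ⟩
  g (suc n)                   ∎
  where open ≡-Reasoning

⋆-congˡ : ∀ {f f′} g → f ≗ f′ → f ⋆ g ≗ f′ ⋆ g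
⋆-congˡ g e zero = cong (_* g 0) (e 0)
⋆-congˡ g e (suc n) = cong₂ _+_ (cong (_* g (suc n)) (e 0)) (⋆-congˡ g (e ∘ suc) n)

⋆-congʳ : ∀ f {g g′} → g ≗ g′ → f ⋆ g ≗ f ⋆ g′
⋆-congʳ f e zero = cong (f 0 *_) (e 0)
⋆-congʳ f e (suc n) = cong₂ _+_ (cong (f 0 *_) (e (suc n))) (⋆-congʳ (f ∘ suc) e n)

⋆-unfoldʳ : ∀ f g n → (f ⋆ g) (suc n) ≡ (f ⋆ (g ∘ suc)) n + f (suc n) * g 0
⋆-unfoldʳ f g zero = refl
⋆-unfoldʳ f g (suc n) = begin
  f 0 * g (2 ℕ.+ n) + ((f ∘ suc) ⋆ g) (suc n)
    ≡⟨ cong (_+_ (f 0 * g (2 ℕ.+ n))) (⋆-unfoldʳ (f ∘ suc) g n) ⟩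
  f 0 * g (2 ℕ.+ n) + (((f ∘ suc) ⋆ (g ∘ suc)) n + f (2 ℕ.+ n) * g 0)
    ≡⟨ +-assoc (f 0 * g (2 ℕ.+ n)) _ _ ⟨
  (f ⋆ (g ∘ suc)) (suc n) + f (2 ℕ.+ n) * g 0
    ∎
  where open ≡-Reasoning

⋆-comm : ∀ f g → f ⋆ g ≗ g ⋆ f
⋆-comm f g zero = *-comm (f 0) (g 0)
⋆-comm f g (suc n) = begin
  f 0 * g (suc n) + ((f ∘ suc) ⋆ g) n
    ≡⟨ cong₂ _+_ (*-comm (f 0) (g (suc n))) (⋆-comm (f ∘ suc) g n) ⟩
  g (suc n) * f 0 + (g ⋆ (f ∘ suc)) n
    ≡⟨ +-comm (g (suc n) * f 0) _ ⟩
  (g ⋆ (f ∘ suc)) n + g (suc n) * f 0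
    ≡⟨ ⋆-unfoldʳ g f n ⟨
  (g ⋆ f) (suc n)
    ∎
  where open ≡-Reasoning

⋆-distribʳ-+ : ∀ f g h → (λ k → f k + g k) ⋆ h ≗ λ n → (f ⋆ h) n + (g ⋆ h) n
⋆-distribʳ-+ f g h zero = *-distribʳ-+ (h 0) (f 0) (g 0)
⋆-distribʳ-+ f g h (suc n) = trans
  (cong (_+_ ((f 0 + g 0) * h (suc n))) (⋆-distribʳ-+ (f ∘ suc) (g ∘ suc) h n))
  (interchange (f 0) (g 0) (h (suc n)) _ _)
  where
  interchange : ∀ a b c x y → (a + b) * c + (x + y) ≡ (a * c + x) + (b * c + y)
  interchange = solve-∀

⋆-distribʳ-- : ∀ f g h → (λ k → f k - g k) ⋆ h ≗ λ n → (f ⋆ h) n - (g ⋆ h) n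
⋆-distribʳ-- f g h zero = distrib (f 0) (g 0) (h 0)
  where
  distrib : ∀ a b c → (a - b) * c ≡ a * c - b * c
  distrib = solve-∀
⋆-distribʳ-- f g h (suc n) = trans
  (cong (_+_ ((f 0 - g 0) * h (suc n))) (⋆-distribʳ-- (f ∘ suc) (g ∘ suc) h n))
  (interchange (f 0) (g 0) (h (suc n)) _ _)
  where
  interchange : ∀ a b c x y → (a - b) * c + (x - y) ≡ (a * c + x) - (b * c + y)
  interchange = solve-∀

⋆-scaleˡ : ∀ a f g → (λ k → a * f k) ⋆ g ≗ λ n → a * (f ⋆ g) n
⋆-scaleˡ a f g zero = *-assoc a (f 0) (g 0)
⋆-scaleˡ a f g (suc n) = trans
  (cong (_+_ (a * f 0 * g (suc n))) (⋆-scaleˡ a (f ∘ suc) g n))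
  (factor a (f 0) (g (suc n)) _)
  where
  factor : ∀ a b c x → a * b * c + a * x ≡ a * (b * c + x)
  factor = solve-∀

⋆-assoc : ∀ f g h → (f ⋆ g) ⋆ h ≗ f ⋆ (g ⋆ h)
⋆-assoc f g h zero = *-assoc (f 0) (g 0) (h 0)
⋆-assoc f g h (suc n) = begin
  f 0 * g 0 * h (suc n) + ((λ k → f 0 * g (suc k) + ((f ∘ suc) ⋆ g) k) ⋆ h) n
    ≡⟨ cong (_+_ (f 0 * g 0 * h (suc n))) (⋆-distribʳ-+ _ _ h n) ⟩
  f 0 * g 0 * h (suc n) + (((λ k → f 0 * g (suc k)) ⋆ h) n + (((f ∘ suc) ⋆ g) ⋆ h) n)
    ≡⟨ cong₂ (λ x y → f 0 * g 0 * h (suc n) + (x + y))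
             (⋆-scaleˡ (f 0) (g ∘ suc) h n) (⋆-assoc (f ∘ suc) g h n) ⟩
  f 0 * g 0 * h (suc n) + (f 0 * ((g ∘ suc) ⋆ h) n + ((f ∘ suc) ⋆ (g ⋆ h)) n)
    ≡⟨ factor (f 0) (g 0) (h (suc n)) _ _ ⟩
  f 0 * (g ⋆ h) (suc n) + ((f ∘ suc) ⋆ (g ⋆ h)) n
    ∎
  where
  open ≡-Reasoning
  factor : ∀ a b c x y → a * b * c + (a * x + y) ≡ a * (b * c + x) + y
  factor = solve-∀

⋆-ratio-inverse : ∀ {p q f u} → q ⋆ f ≗ p → p ⋆ u ≗ 𝟙 → (q ⋆ u) ⋆ f ≗ 𝟙
⋆-ratio-inverse {p} {q} {f} {u} qf≗p pu≗𝟙 n = begin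
  ((q ⋆ u) ⋆ f) n ≡⟨ ⋆-congˡ f (⋆-comm q u) n ⟩
  ((u ⋆ q) ⋆ f) n ≡⟨ ⋆-assoc u q f n ⟩
  (u ⋆ (q ⋆ f)) n ≡⟨ ⋆-congʳ u qf≗p n ⟩
  (u ⋆ p) n       ≡⟨ ⋆-comm u p n ⟩
  (p ⋆ u) n       ≡⟨ pu≗𝟙 n ⟩
  𝟙 n             ∎
  where open ≡-Reasoning

⋆-difference-of-ratios : ∀ {pS qS pD qD S D U V} →
  qS ⋆ S ≗ pS → qD ⋆ D ≗ pD → pS ⋆ U ≗ 𝟙 → pD ⋆ V ≗ 𝟙 →
  (λ k → (qD ⋆ V) k - (qS ⋆ U) k) ⋆ S ⋆ D ≗ λ n → S n - D n
⋆-difference-of-ratios {pS} {qS} {pD} {qD} {S} {D} {U} {V} qS⋆S qD⋆D pS⋆U pD⋆V n = begin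
  ((λ k → (qD ⋆ V) k - (qS ⋆ U) k) ⋆ S ⋆ D) n
    ≡⟨ ⋆-congˡ D (⋆-distribʳ-- (qD ⋆ V) (qS ⋆ U) S) n ⟩
  ((λ k → (qD ⋆ V ⋆ S) k - (qS ⋆ U ⋆ S) k) ⋆ D) n
    ≡⟨ ⋆-distribʳ-- (qD ⋆ V ⋆ S) (qS ⋆ U ⋆ S) D n ⟩
  (qD ⋆ V ⋆ S ⋆ D) n - (qS ⋆ U ⋆ S ⋆ D) n
    ≡⟨ cong₂ _-_ first second ⟩
  S n - D n
    ∎
  where
  open ≡-Reasoning
  first : (qD ⋆ V ⋆ S ⋆ D) n ≡ S n
  first = begin
    (qD ⋆ V ⋆ S ⋆ D) n   ≡⟨ ⋆-assoc (qD ⋆ V) S D n ⟩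
    (qD ⋆ V ⋆ (S ⋆ D)) n ≡⟨ ⋆-congʳ (qD ⋆ V) (⋆-comm S D) n ⟩
    (qD ⋆ V ⋆ (D ⋆ S)) n ≡⟨ ⋆-assoc (qD ⋆ V) D S n ⟨
    (qD ⋆ V ⋆ D ⋆ S) n   ≡⟨ ⋆-congˡ S (⋆-ratio-inverse qD⋆D pD⋆V) n ⟩
    (𝟙 ⋆ S) n            ≡⟨ ⋆-identityˡ S n ⟩
    S n                  ∎
  second : (qS ⋆ U ⋆ S ⋆ D) n ≡ D n
  second = trans (⋆-congˡ D (⋆-ratio-inverse qS⋆S pS⋆U) n) (⋆-identityˡ D n)

poly : List ℤ → Seq
poly [] _ = + 0
poly (a ∷ _) zero = a
poly (_ ∷ as) (suc n) = poly as n

recurrenceSum : List ℤ → Seq → ℕ → ℤ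
recurrenceSum [] f m = + 0
recurrenceSum (a ∷ as) f m = a * f (length as ℕ.+ m) + recurrenceSum as f m

Annihilates : List ℤ → Seq → Set
Annihilates q f = ∀ m → recurrenceSum q f m ≡ + 0

poly-⋆ : ∀ q f m → (poly q ⋆ f) (length q ℕ.+ m) ≡ recurrenceSum q (f ∘ suc) m
poly-⋆ [] f m = ⋆-zeroˡ f m
poly-⋆ (a ∷ q) f m = cong (_+_ (a * f (suc (length q ℕ.+ m)))) (poly-⋆ q f m)

poly-⋆-annihilated : ∀ q f → Annihilates q (f ∘ suc) →
  ∀ m → (poly q ⋆ f) (length q ℕ.+ m) ≡ + 0
poly-⋆-annihilated q f ann m = trans (poly-⋆ q f m) (ann m)

tribonacciPoly padovanPoly tribonacciSquarePoly narayanaSquarePoly : List ℤ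
tribonacciPoly = + 1 ∷ - + 1 ∷ - + 1 ∷ - + 1 ∷ []
padovanPoly = + 1 ∷ + 0 ∷ - + 1 ∷ - + 1 ∷ []
tribonacciSquarePoly = + 1 ∷ - + 2 ∷ - + 3 ∷ - + 6 ∷ + 1 ∷ + 0 ∷ + 1 ∷ []
narayanaSquarePoly = + 1 ∷ - + 1 ∷ - + 1 ∷ - + 3 ∷ - + 1 ∷ + 1 ∷ + 1 ∷ []

TribonacciLike NarayanaLike PadovanLike : Seq → Set
TribonacciLike u = ∀ n → u (3 ℕ.+ n) ≡ u (2 ℕ.+ n) + u (1 ℕ.+ n) + u n
NarayanaLike u = ∀ n → u (3 ℕ.+ n) ≡ u (2 ℕ.+ n) + u n
PadovanLike u = ∀ n → u (3 ℕ.+ n) ≡ u (1 ℕ.+ n) + u n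

tribonacciLike-annihilated : ∀ {u} → TribonacciLike u → Annihilates tribonacciPoly u
tribonacciLike-annihilated {u} rec m = identity (u m) (u (1 ℕ.+ m)) (u (2 ℕ.+ m)) _ (rec m)
  where
  -- The left side is recurrenceSum unfolded. The recurrence enters as equations, so matching
  -- them with refl substitutes it before the ring solver runs; the same pattern recurs below.
  identity : ∀ x y z a₃ → a₃ ≡ z + y + x →
    + 1 * a₃ + (- + 1 * z + (- + 1 * y + (- + 1 * x + + 0))) ≡ + 0
  identity x y z _ refl = solve (x ∷ y ∷ z ∷ [])

padovanLike-annihilated : ∀ {u} → PadovanLike u → Annihilates padovanPoly u
padovanLike-annihilated {u} rec m = identity (u m) (u (1 ℕ.+ m)) (u (2 ℕ.+ m)) _ (rec m)
  where
  identity : ∀ x y z a₃ → a₃ ≡ y + x →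
    + 1 * a₃ + (+ 0 * z + (- + 1 * y + (- + 1 * x + + 0))) ≡ + 0
  identity x y z _ refl = solve (x ∷ y ∷ z ∷ [])

tribonacciLike-squares-annihilated : ∀ {u} → TribonacciLike u →
  Annihilates tribonacciSquarePoly (λ n → u n * u n)
tribonacciLike-squares-annihilated {u} rec m =
  identity (u m) (u (1 ℕ.+ m)) (u (2 ℕ.+ m)) _ _ _ _
    (rec m) (rec (1 ℕ.+ m)) (rec (2 ℕ.+ m)) (rec (3 ℕ.+ m))
  where
  identity : ∀ x y z a₃ a₄ a₅ a₆ →
    a₃ ≡ z + y + x → a₄ ≡ a₃ + z + y → a₅ ≡ a₄ + a₃ + z → a₆ ≡ a₅ + a₄ + a₃ →
    + 1 * (a₆ * a₆) + (- + 2 * (a₅ * a₅) + (- + 3 * (a₄ * a₄) + (- + 6 * (a₃ * a₃) +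
      (+ 1 * (z * z) + (+ 0 * (y * y) + (+ 1 * (x * x) + + 0)))))) ≡ + 0
  identity x y z _ _ _ _ refl refl refl refl = solve (x ∷ y ∷ z ∷ [])

narayanaLike-squares-annihilated : ∀ {u} → NarayanaLike u →
  Annihilates narayanaSquarePoly (λ n → u n * u n)
narayanaLike-squares-annihilated {u} rec m =
  identity (u m) (u (1 ℕ.+ m)) (u (2 ℕ.+ m)) _ _ _ _
    (rec m) (rec (1 ℕ.+ m)) (rec (2 ℕ.+ m)) (rec (3 ℕ.+ m))
  where
  identity : ∀ x y z a₃ a₄ a₅ a₆ →
    a₃ ≡ z + x → a₄ ≡ a₃ + y → a₅ ≡ a₄ + z → a₆ ≡ a₅ + a₃ →
    + 1 * (a₆ * a₆) + (- + 1 * (a₅ * a₅) + (- + 1 * (a₄ * a₄) + (- + 3 * (a₃ * a₃) +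
      (- + 1 * (z * z) + (+ 1 * (y * y) + (+ 1 * (x * x) + + 0)))))) ≡ + 0
  identity x y z _ _ _ _ refl refl refl refl = solve (x ∷ y ∷ z ∷ [])

tribonacciLike-recurrenceSum : ∀ {u} → TribonacciLike u →
  ∀ m → recurrenceSum tribonacciSquarePoly u m ≡ - + 4 * (u (4 ℕ.+ m) + u (3 ℕ.+ m))
tribonacciLike-recurrenceSum {u} rec m =
  identity (u m) (u (1 ℕ.+ m)) (u (2 ℕ.+ m)) _ _ _ _
    (rec m) (rec (1 ℕ.+ m)) (rec (2 ℕ.+ m)) (rec (3 ℕ.+ m))
  where
  identity : ∀ x y z a₃ a₄ a₅ a₆ →
    a₃ ≡ z + y + x → a₄ ≡ a₃ + z + y → a₅ ≡ a₄ + a₃ + z → a₆ ≡ a₅ + a₄ + a₃ →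
    + 1 * a₆ + (- + 2 * a₅ + (- + 3 * a₄ + (- + 6 * a₃ + (+ 1 * z + (+ 0 * y + (+ 1 * x + + 0))))))
      ≡ - + 4 * (a₄ + a₃)
  identity x y z _ _ _ _ refl refl refl refl = solve (x ∷ y ∷ z ∷ [])

padovanLike-recurrenceSum : ∀ {u} → PadovanLike u →
  ∀ m → recurrenceSum narayanaSquarePoly u m ≡ - + 2 * u (5 ℕ.+ m)
padovanLike-recurrenceSum {u} rec m =
  identity (u m) (u (1 ℕ.+ m)) (u (2 ℕ.+ m)) _ _ _ _
    (rec m) (rec (1 ℕ.+ m)) (rec (2 ℕ.+ m)) (rec (3 ℕ.+ m))
  where
  identity : ∀ x y z a₃ a₄ a₅ a₆ →
    a₃ ≡ y + x → a₄ ≡ z + y → a₅ ≡ a₃ + z → a₆ ≡ a₄ + a₃ →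
    + 1 * a₆ + (- + 1 * a₅ + (- + 1 * a₄ + (- + 3 * a₃ + (- + 1 * z + (+ 1 * y + (+ 1 * x + + 0))))))
      ≡ - + 2 * a₅
  identity x y z _ _ _ _ refl refl refl refl = solve (x ∷ y ∷ z ∷ [])

sumFromTo-0-peel : ∀ n f → sumFromTo 0 (suc n) f ≡ f 0 + sumFromTo 0 n (f ∘ suc)
sumFromTo-0-peel zero f = shuffle (f 0) (f 1)
  where
  shuffle : ∀ a b → + 0 + a + b ≡ a + (+ 0 + b)
  shuffle = solve-∀
sumFromTo-0-peel (suc n) f = begin
  sumFromTo 0 (suc n) f + f (2 ℕ.+ n)         ≡⟨ cong (_+ f (2 ℕ.+ n)) (sumFromTo-0-peel n f) ⟩
  f 0 + sumFromTo 0 n (f ∘ suc) + f (2 ℕ.+ n) ≡⟨ +-assoc (f 0) _ _ ⟩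
  f 0 + sumFromTo 0 (suc n) (f ∘ suc)         ∎
  where open ≡-Reasoning

sumFromTo-0-*ʳ : ∀ n h x → sumFromTo 0 n (λ k → h k * x) ≡ sumFromTo 0 n h * x
sumFromTo-0-*ʳ zero h x = trans (+-identityˡ (h 0 * x)) (cong (_* x) (sym (+-identityˡ (h 0))))
sumFromTo-0-*ʳ (suc n) h x =
  trans (cong (_+ h (suc n) * x) (sumFromTo-0-*ʳ n h x))
        (sym (*-distribʳ-+ x (sumFromTo 0 n h) (h (suc n))))

sumFromTo-2≡sumFromTo-0 : ∀ n F G → G 0 ≡ + 0 → G 1 ≡ + 0 →
  (∀ l → F (2 ℕ.+ l) ≡ G (2 ℕ.+ l)) → sumFromTo 2 n F ≡ sumFromTo 0 n G
sumFromTo-2≡sumFromTo-0 zero F G G0 G1 F≗G = sym (trans (+-identityˡ (G 0)) G0)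
sumFromTo-2≡sumFromTo-0 (suc zero) F G G0 G1 F≗G = sym (cong₂ (λ a b → + 0 + a + b) G0 G1)
sumFromTo-2≡sumFromTo-0 (suc (suc n)) F G G0 G1 F≗G =
  cong₂ _+_ (sumFromTo-2≡sumFromTo-0 (suc n) F G G0 G1 F≗G) (F≗G n)

⋆-as-sum : ∀ f g n → (f ⋆ g) n ≡ sumFromTo 0 n (λ k → f k * g (n ∸ k))
⋆-as-sum f g zero = sym (+-identityˡ (f 0 * g 0))
⋆-as-sum f g (suc n) = trans
  (cong (_+_ (f 0 * g (suc n))) (⋆-as-sum (f ∘ suc) g n))
  (sym (sumFromTo-0-peel n (λ k → f k * g (suc n ∸ k))))

from2 : Seq → Seq
from2 a zero = + 0
from2 a (suc zero) = + 0
from2 a (suc (suc l)) = a (suc (suc l))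

⋆-as-double-sum : ∀ a g h n →
  (from2 a ⋆ g ⋆ h) n ≡ sumFromTo 2 n (λ k → sumFromTo 2 k (λ l → a l * g (k ∸ l) * h (n ∸ k)))
⋆-as-double-sum a g h n = trans (⋆-as-sum (from2 a ⋆ g) h n)
  (sym (sumFromTo-2≡sumFromTo-0 n _ _ refl refl (inner ∘ (2 ℕ.+_))))
  where
  inner : ∀ k → sumFromTo 2 k (λ l → a l * g (k ∸ l) * h (n ∸ k)) ≡ (from2 a ⋆ g) k * h (n ∸ k)
  inner k = begin
    sumFromTo 2 k (λ l → a l * g (k ∸ l) * h (n ∸ k))
      ≡⟨ sumFromTo-2≡sumFromTo-0 k _ _ refl refl (λ _ → refl) ⟩
    sumFromTo 0 k (λ l → from2 a l * g (k ∸ l) * h (n ∸ k))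
      ≡⟨ sumFromTo-0-*ʳ k (λ l → from2 a l * g (k ∸ l)) (h (n ∸ k)) ⟩
    sumFromTo 0 k (λ l → from2 a l * g (k ∸ l)) * h (n ∸ k)
      ≡⟨ cong (_* h (n ∸ k)) (⋆-as-sum (from2 a) g k) ⟨
    (from2 a ⋆ g) k * h (n ∸ k)
      ∎
    where open ≡-Reasoning

-- T₊₂ is indexed as 2 + n, so that it unfolds along T's recurrence, while T₊₂² keeps the
-- statement's n + 2.
T₊₂ T₊₂² c² pᶻ : Seq
T₊₂ n = + T (2 ℕ.+ n)
T₊₂² n = + T (n ℕ.+ 2) * + T (n ℕ.+ 2)
c² n = + c n * + c n
pᶻ n = + p n

tribonacciSquarePoly⋆T₊₂² : poly tribonacciSquarePoly ⋆ T₊₂² ≗ poly tribonacciPoly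
tribonacciSquarePoly⋆T₊₂² 0 = refl
tribonacciSquarePoly⋆T₊₂² 1 = refl
tribonacciSquarePoly⋆T₊₂² 2 = refl
tribonacciSquarePoly⋆T₊₂² 3 = refl
tribonacciSquarePoly⋆T₊₂² 4 = refl
tribonacciSquarePoly⋆T₊₂² 5 = refl
tribonacciSquarePoly⋆T₊₂² 6 = refl
tribonacciSquarePoly⋆T₊₂² (suc (suc (suc (suc (suc (suc (suc m))))))) =
  poly-⋆-annihilated tribonacciSquarePoly T₊₂²
    (tribonacciLike-squares-annihilated {λ n → + T (suc n ℕ.+ 2)} (λ _ → refl)) m

narayanaSquarePoly⋆c² : poly narayanaSquarePoly ⋆ c² ≗ poly padovanPoly
narayanaSquarePoly⋆c² 0 = refl
narayanaSquarePoly⋆c² 1 = refl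
narayanaSquarePoly⋆c² 2 = refl
narayanaSquarePoly⋆c² 3 = refl
narayanaSquarePoly⋆c² 4 = refl
narayanaSquarePoly⋆c² 5 = refl
narayanaSquarePoly⋆c² 6 = refl
narayanaSquarePoly⋆c² (suc (suc (suc (suc (suc (suc (suc m))))))) =
  poly-⋆-annihilated narayanaSquarePoly c²
    (narayanaLike-squares-annihilated {λ n → + c (suc n)} (λ _ → refl)) m

tribonacciPoly⋆T₊₂ : poly tribonacciPoly ⋆ T₊₂ ≗ 𝟙
tribonacciPoly⋆T₊₂ 0 = refl
tribonacciPoly⋆T₊₂ 1 = refl
tribonacciPoly⋆T₊₂ 2 = refl
tribonacciPoly⋆T₊₂ 3 = refl
tribonacciPoly⋆T₊₂ (suc (suc (suc (suc m)))) =
  poly-⋆-annihilated tribonacciPoly T₊₂ (tribonacciLike-annihilated {T₊₂ ∘ suc} (λ _ → refl)) m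

padovanPoly⋆pᶻ : poly padovanPoly ⋆ pᶻ ≗ 𝟙
padovanPoly⋆pᶻ 0 = refl
padovanPoly⋆pᶻ 1 = refl
padovanPoly⋆pᶻ 2 = refl
padovanPoly⋆pᶻ 3 = refl
padovanPoly⋆pᶻ (suc (suc (suc (suc m)))) =
  poly-⋆-annihilated padovanPoly pᶻ (padovanLike-annihilated {pᶻ ∘ suc} (λ _ → refl)) m

weight : ℕ → ℤ
weight l = + 4 * (+ T l + + T (l ∸ 1)) - δ l 2 - + 2 * + p (l ∸ 1)

from2-weight≗difference :
  from2 weight ≗ λ n → (poly narayanaSquarePoly ⋆ pᶻ) n - (poly tribonacciSquarePoly ⋆ T₊₂) n
from2-weight≗difference 0 = refl
from2-weight≗difference 1 = refl
from2-weight≗difference 2 = refl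
from2-weight≗difference 3 = refl
from2-weight≗difference 4 = refl
from2-weight≗difference 5 = refl
from2-weight≗difference 6 = refl
from2-weight≗difference (suc (suc (suc (suc (suc (suc (suc m))))))) = trans
  (rearrange (+ T (7 ℕ.+ m) + + T (6 ℕ.+ m)) (+ p (6 ℕ.+ m)))
  (sym (cong₂ _-_
    (trans (poly-⋆ narayanaSquarePoly pᶻ m)
           (padovanLike-recurrenceSum {pᶻ ∘ suc} (λ _ → refl) m))
    (trans (poly-⋆ tribonacciSquarePoly T₊₂ m)
           (tribonacciLike-recurrenceSum {T₊₂ ∘ suc} (λ _ → refl) m))))
  where
  rearrange : ∀ x y → + 4 * x - + 0 - + 2 * y ≡ - + 2 * y - - + 4 * x
  rearrange = solve-∀

mainTheorem12 : (n : ℕ) →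
    (+ T (n Data.Nat.+ 2)) * (+ T (n Data.Nat.+ 2)) ≡
      (+ c n) * (+ c n)
      + sumFromTo 2 n (λ k → sumFromTo 2 k (λ l →
          ((+ 4) * (+ T l + + T (l ∸ 1)) - δ l 2 - (+ 2) * (+ p (l ∸ 1)))
          * ((+ T (k ∸ l Data.Nat.+ 2)) * (+ T (k ∸ l Data.Nat.+ 2)))
          * ((+ c (n ∸ k)) * (+ c (n ∸ k)))))
mainTheorem12 n = begin
  T₊₂² n
    ≡⟨ cancel (c² n) (T₊₂² n) ⟨
  c² n + (T₊₂² n - c² n)
    ≡⟨ cong (_+_ (c² n)) convolution ⟨
  c² n + (from2 weight ⋆ T₊₂² ⋆ c²) n
    ≡⟨ cong (_+_ (c² n)) (⋆-as-double-sum weight T₊₂² c² n) ⟩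
  c² n + sumFromTo 2 n (λ k → sumFromTo 2 k (λ l → weight l * T₊₂² (k ∸ l) * c² (n ∸ k)))
    ∎
  where
  open ≡-Reasoning
  cancel : ∀ d s → d + (s - d) ≡ s
  cancel = solve-∀
  convolution : (from2 weight ⋆ T₊₂² ⋆ c²) n ≡ T₊₂² n - c² n
  convolution = trans
    (⋆-congˡ c² (⋆-congˡ T₊₂² from2-weight≗difference) n)
    (⋆-difference-of-ratios tribonacciSquarePoly⋆T₊₂² narayanaSquarePoly⋆c²
       tribonacciPoly⋆T₊₂ padovanPoly⋆pᶻ n)
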